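{- Let $p \geq 3$ be a prime number and let $n \geq 2$ be an integer. There exist infinitely many polynomials of the form $$f(x) = -1 + x + x^{n} + x^{m_1} + \cdots + x^{m_s},$$ with $s \geq 0$, $m_1 - n \geq n-1$ and $m_{j+1} - m_j \geq n-1$ for $1 \leq j < s$, such that $\Phi_p(x)$ divides $f(x)$.
   Context: $\Phi_p(x) = 1 + x + \cdots + x^{p-1}$ denotes the $p$-th cyclotomic polynomial. -}

module Defs where

open import Data.Nat using (ℕ; zero; suc; _≤_; _∸_) renaming (_+_ to _+ℕ_)
open import Data.Integer using (ℤ; +_; -_; _+_; _*_)
open import Data.List using (List; []; _∷_; replicate; _++_; foldr)
open import Data.Product using (∃)
open import Relation.Binary.PropositionalEquality using (_≡_)

-- Polynomials over ℤ as coefficient lists, constant coefficient first.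
Poly : Set
Poly = List ℤ

coeff : Poly → ℕ → ℤ
coeff []       _       = + 0
coeff (a ∷ _)  zero    = a
coeff (_ ∷ as) (suc k) = coeff as k

_+ₚ_ : Poly → Poly → Poly
[]       +ₚ q        = q
(a ∷ as) +ₚ []       = a ∷ as
(a ∷ as) +ₚ (b ∷ bs) = (a + b) ∷ (as +ₚ bs)

scale : ℤ → Poly → Poly
scale c []       = []
scale c (a ∷ as) = (c * a) ∷ scale c as

_*ₚ_ : Poly → Poly → Poly
[]       *ₚ q = []
(a ∷ as) *ₚ q = scale a q +ₚ (+ 0 ∷ (as *ₚ q))

mono : ℤ → ℕ → Poly
mono c k = replicate k (+ 0) ++ (c ∷ [])

_≈ₚ_ : Poly → Poly → Set
f ≈ₚ g = ∀ k → coeff f k ≡ coeff g k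

_∣ₚ_ : Poly → Poly → Set
d ∣ₚ f = ∃ λ (q : Poly) → (d *ₚ q) ≈ₚ f

-- p-th cyclotomic polynomial for p prime: 1 + x + ... + x^(p-1)
Φ : ℕ → Poly
Φ p = replicate p (+ 1)

fPoly : ℕ → List ℕ → Poly
fPoly n ms = mono (- + 1) 0 +ₚ (mono (+ 1) 1 +ₚ (mono (+ 1) n +ₚ
             foldr (λ m acc → mono (+ 1) m +ₚ acc) [] ms))

Gap : ℕ → ℕ → ℕ → Set
Gap n a b = a +ℕ (n ∸ 1) ≤ b

module Submission where

-- Write p = 1 + p₁, n = 1 + g and put N = 1 + (n + g)·p, so N ≡ 1 (mod p).
-- Modulo Φ_p we have x^p ≡ 1, hence x^(j·N + a) ≡ x^(a + j) and
--     Σ_{j<p} x^(j·N + a) ≡ x^a · Φ_p(x) ≡ 0.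
-- For every k take M = (N + k)·p and
--     f_k = -1 + x + x^n + Σ_{1≤j<p} (x^(j·N+1) + x^(j·N+n)) + x^M
--         = (x^M - 1) + Σ_{j<p} x^(j·N+1) + Σ_{j<p} x^(j·N+n),
-- a sum of three multiples of Φ_p.  The exponents n < N+1 < N+n < 2N+1 < ... < M
-- have gaps at least n - 1, and f_k is determined by its leading exponent M,
-- so distinct k give distinct polynomials.

open import Defs
open import Data.Nat using (ℕ; _≤_; _∸_)
open import Data.Nat.Primality using (Prime)
open import Data.List using (List; _∷_)
open import Data.List.Relation.Unary.Linked using (Linked)
open import Data.Product using (Σ; _×_)
open import Relation.Binary.PropositionalEquality using (_≡_)

open import Data.Nat using (zero; suc; _<_; _+_; _*_; s≤s; z≤n)
open import Data.Nat.Properties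
  using (≤-reflexive; ≤-trans; <-≤-trans; ≤-<-trans; <⇒≤; <⇒≢; <-cmp; +-assoc; +-comm; +-identityʳ;
         m≤m+n; +-monoʳ-≤; +-monoˡ-≤; +-monoʳ-<; *-comm; m≤m*n; *-monoˡ-≤; *-monoˡ-<)
open import Data.Integer using (ℤ; +_; -_) renaming (_+_ to _+ᶻ_; _*_ to _*ᶻ_; _-_ to _-ᶻ_)
import Data.Integer.Properties as ℤ
open import Data.Integer.Tactic.RingSolver using (solve-∀)
import Data.Nat.Tactic.RingSolver as ℕ
open import Data.List using ([]; foldr)
open import Data.List.Relation.Unary.Linked using ([-]; _∷_)
open import Data.Product using (_,_)
open import Data.Empty using (⊥; ⊥-elim)
open import Relation.Binary.Definitions using (tri<; tri≈; tri>)
open import Relation.Binary.PropositionalEquality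
  using (_≗_; _≢_; refl; sym; trans; cong; cong₂; subst; module ≡-Reasoning)

open ≡-Reasoning

+-interchange : ∀ (a b c d : ℤ) → (a +ᶻ b) +ᶻ (c +ᶻ d) ≡ (a +ᶻ c) +ᶻ (b +ᶻ d)
+-interchange = solve-∀

-‿+-cancel : ∀ (a b : ℤ) → (a -ᶻ b) +ᶻ b ≡ a
-‿+-cancel = solve-∀

-‿+-chain : ∀ (a b c : ℤ) → (a -ᶻ b) +ᶻ (b -ᶻ c) ≡ a -ᶻ c
-‿+-chain = solve-∀

+-regroup-row : ∀ (a b s m : ℤ) → a +ᶻ (b +ᶻ (s +ᶻ m)) ≡ ((a +ᶻ b) +ᶻ s) +ᶻ m
+-regroup-row = solve-∀

+-regroup-f : ∀ (z a b s m : ℤ) → - z +ᶻ (a +ᶻ (b +ᶻ (s +ᶻ m))) ≡ (m -ᶻ z) +ᶻ ((a +ᶻ b) +ᶻ s)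
+-regroup-f = solve-∀

-- A polynomial is handled through its coefficient function.
Seq : Set
Seq = ℕ → ℤ

0ₛ : Seq
0ₛ _ = + 0

infixl 6 _⊕_ _⊝_

_⊕_ _⊝_ : Seq → Seq → Seq
(f ⊕ g) k = f k +ᶻ g k
(f ⊝ g) k = f k -ᶻ g k

sh : Seq → Seq
sh f zero    = + 0
sh f (suc k) = f k

δ : ℕ → Seq
δ zero zero    = + 1
δ zero (suc k) = + 0
δ (suc m)      = sh (δ m)

sumₛ : ℕ → (ℕ → Seq) → Seq
sumₛ zero    f = 0ₛ
sumₛ (suc r) f = f 0 ⊕ sumₛ r (λ j → f (suc j))

δ-self : ∀ m → δ m m ≡ + 1
δ-self zero    = refl
δ-self (suc m) = δ-self m

δ-other : ∀ m k → m ≢ k → δ m k ≡ + 0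
δ-other zero    zero    m≢k = ⊥-elim (m≢k refl)
δ-other zero    (suc k) m≢k = refl
δ-other (suc m) zero    m≢k = refl
δ-other (suc m) (suc k) m≢k = δ-other m k (λ m≡k → m≢k (cong suc m≡k))

sh-cong : ∀ {f g} → f ≗ g → sh f ≗ sh g
sh-cong f≗g zero    = refl
sh-cong f≗g (suc k) = f≗g k

sh-⊕ : ∀ f g → sh (f ⊕ g) ≗ sh f ⊕ sh g
sh-⊕ f g zero    = refl
sh-⊕ f g (suc k) = refl

sh-⊝ : ∀ f g → sh (f ⊝ g) ≗ sh f ⊝ sh g
sh-⊝ f g zero    = refl
sh-⊝ f g (suc k) = refl

sum-ext : ∀ r {f g : ℕ → Seq} → (∀ j → f j ≗ g j) → sumₛ r f ≗ sumₛ r g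
sum-ext zero    f≗g k = refl
sum-ext (suc r) f≗g k = cong₂ _+ᶻ_ (f≗g 0 k) (sum-ext r (λ j → f≗g (suc j)) k)

sum-⊕ : ∀ r (f g : ℕ → Seq) → sumₛ r (λ j → f j ⊕ g j) ≗ sumₛ r f ⊕ sumₛ r g
sum-⊕ zero    f g k = refl
sum-⊕ (suc r) f g k = begin
  (f 0 k +ᶻ g 0 k) +ᶻ sumₛ r (λ j → f (suc j) ⊕ g (suc j)) k
    ≡⟨ cong ((f 0 k +ᶻ g 0 k) +ᶻ_) (sum-⊕ r (λ j → f (suc j)) (λ j → g (suc j)) k) ⟩
  (f 0 k +ᶻ g 0 k) +ᶻ (sumₛ r (λ j → f (suc j)) k +ᶻ sumₛ r (λ j → g (suc j)) k)
    ≡⟨ +-interchange (f 0 k) (g 0 k) _ _ ⟩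
  (f 0 k +ᶻ sumₛ r (λ j → f (suc j)) k) +ᶻ (g 0 k +ᶻ sumₛ r (λ j → g (suc j)) k) ∎

sum-sh : ∀ r (f : ℕ → Seq) → sumₛ r (λ j → sh (f j)) ≗ sh (sumₛ r f)
sum-sh zero    f zero    = refl
sum-sh zero    f (suc k) = refl
sum-sh (suc r) f k = trans (cong (sh (f 0) k +ᶻ_) (sum-sh r (λ j → f (suc j)) k))
                           (sym (sh-⊕ (f 0) (sumₛ r (λ j → f (suc j))) k))

sum-vanish : ∀ r (f : ℕ → Seq) X → (∀ j → j < r → f j X ≡ + 0) → sumₛ r f X ≡ + 0
sum-vanish zero    f X vanish = refl
sum-vanish (suc r) f X vanish =
  cong₂ _+ᶻ_ (vanish 0 (s≤s z≤n)) (sum-vanish r (λ j → f (suc j)) X (λ j j<r → vanish (suc j) (s≤s j<r)))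

coeff-+ₚ : ∀ f g → coeff (f +ₚ g) ≗ coeff f ⊕ coeff g
coeff-+ₚ []       g        k       = sym (ℤ.+-identityˡ _)
coeff-+ₚ (a ∷ as) []       k       = sym (ℤ.+-identityʳ _)
coeff-+ₚ (a ∷ as) (b ∷ bs) zero    = refl
coeff-+ₚ (a ∷ as) (b ∷ bs) (suc k) = coeff-+ₚ as bs k

coeff-scale : ∀ c f k → coeff (scale c f) k ≡ c *ᶻ coeff f k
coeff-scale c []       k       = sym (ℤ.*-zeroʳ c)
coeff-scale c (a ∷ as) zero    = refl
coeff-scale c (a ∷ as) (suc k) = coeff-scale c as k

coeff-0∷ : ∀ f → coeff (+ 0 ∷ f) ≗ sh (coeff f)
coeff-0∷ f zero    = refl
coeff-0∷ f (suc k) = refl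

coeff-*ₚ : ∀ a as q k → coeff ((a ∷ as) *ₚ q) k ≡ a *ᶻ coeff q k +ᶻ sh (coeff (as *ₚ q)) k
coeff-*ₚ a as q k = trans (coeff-+ₚ (scale a q) _ k) (cong₂ _+ᶻ_ (coeff-scale a q k) (coeff-0∷ _ k))

coeff-mono : ∀ m → coeff (mono (+ 1) m) ≗ δ m
coeff-mono zero    zero    = refl
coeff-mono zero    (suc k) = refl
coeff-mono (suc m) k       = trans (coeff-0∷ (mono (+ 1) m) k) (sh-cong (coeff-mono m) k)

*ₚ-+ₚ : ∀ d q₁ q₂ → coeff (d *ₚ (q₁ +ₚ q₂)) ≗ coeff (d *ₚ q₁) ⊕ coeff (d *ₚ q₂)
*ₚ-+ₚ []       q₁ q₂ k = refl
*ₚ-+ₚ (a ∷ as) q₁ q₂ k = begin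
  coeff ((a ∷ as) *ₚ (q₁ +ₚ q₂)) k
    ≡⟨ coeff-*ₚ a as (q₁ +ₚ q₂) k ⟩
  a *ᶻ coeff (q₁ +ₚ q₂) k +ᶻ sh (coeff (as *ₚ (q₁ +ₚ q₂))) k
    ≡⟨ cong₂ (λ u v → a *ᶻ u +ᶻ v) (coeff-+ₚ q₁ q₂ k)
             (trans (sh-cong (*ₚ-+ₚ as q₁ q₂) k) (sh-⊕ (coeff (as *ₚ q₁)) (coeff (as *ₚ q₂)) k)) ⟩
  a *ᶻ (coeff q₁ k +ᶻ coeff q₂ k) +ᶻ (sh (coeff (as *ₚ q₁)) k +ᶻ sh (coeff (as *ₚ q₂)) k)
    ≡⟨ cong (_+ᶻ _) (ℤ.*-distribˡ-+ a (coeff q₁ k) (coeff q₂ k)) ⟩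
  (a *ᶻ coeff q₁ k +ᶻ a *ᶻ coeff q₂ k) +ᶻ (sh (coeff (as *ₚ q₁)) k +ᶻ sh (coeff (as *ₚ q₂)) k)
    ≡⟨ +-interchange (a *ᶻ coeff q₁ k) _ _ _ ⟩
  (a *ᶻ coeff q₁ k +ᶻ sh (coeff (as *ₚ q₁)) k) +ᶻ (a *ᶻ coeff q₂ k +ᶻ sh (coeff (as *ₚ q₂)) k)
    ≡⟨ sym (cong₂ _+ᶻ_ (coeff-*ₚ a as q₁ k) (coeff-*ₚ a as q₂ k)) ⟩
  coeff ((a ∷ as) *ₚ q₁) k +ᶻ coeff ((a ∷ as) *ₚ q₂) k ∎

*ₚ-0∷ : ∀ d q → coeff (d *ₚ (+ 0 ∷ q)) ≗ sh (coeff (d *ₚ q))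
*ₚ-0∷ []       q zero    = refl
*ₚ-0∷ []       q (suc k) = refl
*ₚ-0∷ (a ∷ as) q zero    = trans (coeff-*ₚ a as (+ 0 ∷ q) zero) (trans (ℤ.+-identityʳ _) (ℤ.*-zeroʳ a))
*ₚ-0∷ (a ∷ as) q (suc k) = begin
  coeff ((a ∷ as) *ₚ (+ 0 ∷ q)) (suc k)       ≡⟨ coeff-*ₚ a as (+ 0 ∷ q) (suc k) ⟩
  a *ᶻ coeff q k +ᶻ coeff (as *ₚ (+ 0 ∷ q)) k ≡⟨ cong (a *ᶻ coeff q k +ᶻ_) (*ₚ-0∷ as q k) ⟩
  a *ᶻ coeff q k +ᶻ sh (coeff (as *ₚ q)) k    ≡⟨ sym (coeff-*ₚ a as q k) ⟩
  coeff ((a ∷ as) *ₚ q) k                     ∎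

*ₚ-[] : ∀ d → coeff (d *ₚ []) ≗ 0ₛ
*ₚ-[] []       k       = refl
*ₚ-[] (a ∷ as) zero    = refl
*ₚ-[] (a ∷ as) (suc k) = *ₚ-[] as k

*ₚ-1 : ∀ d → coeff (d *ₚ (+ 1 ∷ [])) ≗ coeff d
*ₚ-1 []       k       = refl
*ₚ-1 (a ∷ as) zero    = trans (ℤ.+-identityʳ _) (ℤ.*-identityʳ a)
*ₚ-1 (a ∷ as) (suc k) = *ₚ-1 as k

infix 4 _∣ₛ_

record _∣ₛ_ (d : Poly) (h : Seq) : Set where
  constructor _,_
  field
    quotient : Poly
    product  : coeff (d *ₚ quotient) ≗ h

∣ₛ⇒∣ₚ : ∀ {d f} → d ∣ₛ coeff f → d ∣ₚ f
∣ₛ⇒∣ₚ (q , dq≗f) = q , dq≗f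

module _ {d : Poly} where

  ∣ₛ-resp : ∀ {h g} → h ≗ g → d ∣ₛ h → d ∣ₛ g
  ∣ₛ-resp h≗g (q , dq≗h) = q , λ k → trans (dq≗h k) (h≗g k)

  ∣ₛ-0 : d ∣ₛ 0ₛ
  ∣ₛ-0 = [] , *ₚ-[] d

  ∣ₛ-⊕ : ∀ {h g} → d ∣ₛ h → d ∣ₛ g → d ∣ₛ h ⊕ g
  ∣ₛ-⊕ (q₁ , e₁) (q₂ , e₂) = q₁ +ₚ q₂ , λ k → trans (*ₚ-+ₚ d q₁ q₂ k) (cong₂ _+ᶻ_ (e₁ k) (e₂ k))

  ∣ₛ-sh : ∀ {h} → d ∣ₛ h → d ∣ₛ sh h
  ∣ₛ-sh (q , e) = + 0 ∷ q , λ k → trans (*ₚ-0∷ d q k) (sh-cong e k)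

  ∣ₛ-sum : ∀ r {f : ℕ → Seq} → (∀ j → d ∣ₛ f j) → d ∣ₛ sumₛ r f
  ∣ₛ-sum zero    div = ∣ₛ-0
  ∣ₛ-sum (suc r) div = ∣ₛ-⊕ (div 0) (∣ₛ-sum r (λ j → div (suc j)))

  ∣ₛ-sum-transfer : ∀ r {f g : ℕ → Seq} → (∀ j → d ∣ₛ f j ⊝ g j) → d ∣ₛ sumₛ r g → d ∣ₛ sumₛ r f
  ∣ₛ-sum-transfer r {f} {g} div-diff div-g =
    ∣ₛ-resp regroup (∣ₛ-⊕ (∣ₛ-sum r div-diff) div-g)
    where
    regroup : sumₛ r (λ j → f j ⊝ g j) ⊕ sumₛ r g ≗ sumₛ r f
    regroup k = begin
      sumₛ r (λ j → f j ⊝ g j) k +ᶻ sumₛ r g k ≡⟨ sym (sum-⊕ r (λ j → f j ⊝ g j) g k) ⟩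
      sumₛ r (λ j → f j ⊝ g j ⊕ g j) k        ≡⟨ sum-ext r (λ j k → -‿+-cancel (f j k) (g j k)) k ⟩
      sumₛ r f k                              ∎

  mono-shift : ∀ a b → d ∣ₛ δ a ⊝ δ b → ∀ m → d ∣ₛ δ (m + a) ⊝ δ (m + b)
  mono-shift a b div zero    = div
  mono-shift a b div (suc m) = ∣ₛ-resp (sh-⊝ (δ (m + a)) (δ (m + b))) (∣ₛ-sh (mono-shift a b div m))

  mono-shift₁ : ∀ a → d ∣ₛ δ a ⊝ δ 0 → ∀ m → d ∣ₛ δ (m + a) ⊝ δ m
  mono-shift₁ a div m = subst (λ b → d ∣ₛ δ (m + a) ⊝ δ b) (+-identityʳ m) (mono-shift a 0 div m)

  mono-trans : ∀ a b c → d ∣ₛ δ a ⊝ δ b → d ∣ₛ δ b ⊝ δ c → d ∣ₛ δ a ⊝ δ c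
  mono-trans a b c div₁ div₂ = ∣ₛ-resp (λ k → -‿+-chain (δ a k) (δ b k) (δ c k)) (∣ₛ-⊕ div₁ div₂)

  mono-mod : ∀ p → d ∣ₛ δ p ⊝ δ 0 → ∀ m c → d ∣ₛ δ (m + c * p) ⊝ δ m
  mono-mod p div m c = mono-shift₁ (c * p) (multiple c) m
    where
    multiple : ∀ c → d ∣ₛ δ (c * p) ⊝ δ 0
    multiple zero    = ∣ₛ-resp (λ k → sym (ℤ.+-inverseʳ (δ 0 k))) ∣ₛ-0
    multiple (suc c) = mono-trans (p + c * p) p 0 (mono-shift₁ (c * p) (multiple c) p) div

coeff-1∷ : ∀ f → coeff (+ 1 ∷ f) ≗ δ 0 ⊕ sh (coeff f)
coeff-1∷ f zero    = refl
coeff-1∷ f (suc k) = sym (ℤ.+-identityˡ (coeff f k))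

coeff-Φ : ∀ r → coeff (Φ r) ≗ sumₛ r δ
coeff-Φ zero    k = refl
coeff-Φ (suc r) k = trans (coeff-1∷ (Φ r) k)
  (cong (δ 0 k +ᶻ_) (trans (sh-cong (coeff-Φ r) k) (sym (sum-sh r δ k))))

x-1 : Poly
x-1 = - + 1 ∷ + 1 ∷ []

coeff-x-1 : coeff x-1 ≗ δ 1 ⊝ δ 0
coeff-x-1 zero          = refl
coeff-x-1 (suc zero)    = refl
coeff-x-1 (suc (suc k)) = refl

Φ-telescope : ∀ r → coeff (Φ r *ₚ x-1) ≗ δ r ⊝ δ 0
Φ-telescope zero    k = sym (ℤ.+-inverseʳ (δ 0 k))
Φ-telescope (suc r) k = begin
  coeff (Φ (suc r) *ₚ x-1) k
    ≡⟨ coeff-*ₚ (+ 1) (Φ r) x-1 k ⟩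
  + 1 *ᶻ coeff x-1 k +ᶻ sh (coeff (Φ r *ₚ x-1)) k
    ≡⟨ cong₂ _+ᶻ_ (trans (ℤ.*-identityˡ _) (coeff-x-1 k))
                  (trans (sh-cong (Φ-telescope r) k) (sh-⊝ (δ r) (δ 0) k)) ⟩
  (δ 1 k -ᶻ δ 0 k) +ᶻ (δ (suc r) k -ᶻ δ 1 k)
    ≡⟨ ℤ.+-comm (δ 1 k -ᶻ δ 0 k) _ ⟩
  (δ (suc r) k -ᶻ δ 1 k) +ᶻ (δ 1 k -ᶻ δ 0 k)
    ≡⟨ -‿+-chain (δ (suc r) k) (δ 1 k) (δ 0 k) ⟩
  δ (suc r) k -ᶻ δ 0 k ∎

Φ∣xᵖ-1 : ∀ p → Φ p ∣ₛ δ p ⊝ δ 0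
Φ∣xᵖ-1 p = x-1 , Φ-telescope p

Φ∣xᵃΦ : ∀ p a → Φ p ∣ₛ sumₛ p (λ j → δ (a + j))
Φ∣xᵃΦ p zero    = ∣ₛ-resp (coeff-Φ p) (+ 1 ∷ [] , *ₚ-1 (Φ p))
Φ∣xᵃΦ p (suc a) = ∣ₛ-resp (λ k → sym (sum-sh p (λ j → δ (a + j)) k)) (∣ₛ-sh (Φ∣xᵃΦ p a))

row-exponent : ∀ (a j t p : ℕ) → (a + j) + (j * t) * p ≡ j * suc (t * p) + a
row-exponent = ℕ.solve-∀

-- For N = 1 + t·p we have N ≡ 1 (mod p), so x^(j·N + a) ≡ x^(a + j) modulo Φ p and
-- the row sum Σ_{j<p} x^(j·N + a) is congruent to x^a · Φ p.
Φ∣row-sum : ∀ p t a → Φ p ∣ₛ sumₛ p (λ j → δ (j * suc (t * p) + a))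
Φ∣row-sum p t a = ∣ₛ-sum-transfer p termwise (Φ∣xᵃΦ p a)
  where
  termwise : ∀ j → Φ p ∣ₛ δ (j * suc (t * p) + a) ⊝ δ (a + j)
  termwise j = subst (λ e → Φ p ∣ₛ δ e ⊝ δ (a + j)) (row-exponent a j t p)
                     (mono-mod p (Φ∣xᵖ-1 p) (a + j) (j * t))

listSeq : List ℕ → Seq
listSeq = foldr (λ m acc → δ m ⊕ acc) 0ₛ

monos : List ℕ → Poly
monos = foldr (λ m acc → mono (+ 1) m +ₚ acc) []

coeff-monos : ∀ ms → coeff (monos ms) ≗ listSeq ms
coeff-monos []       k = refl
coeff-monos (m ∷ ms) k =
  trans (coeff-+ₚ (mono (+ 1) m) (monos ms) k) (cong₂ _+ᶻ_ (coeff-mono m k) (coeff-monos ms k))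

coeff-fPoly : ∀ n ms k → coeff (fPoly n ms) k ≡ - δ 0 k +ᶻ (δ 1 k +ᶻ (δ n k +ᶻ listSeq ms k))
coeff-fPoly n ms k =
  trans (coeff-+ₚ (mono (- + 1) 0) (mono (+ 1) 1 +ₚ (mono (+ 1) n +ₚ monos ms)) k)
  (cong₂ _+ᶻ_ (coeff-minus-one k)
  (trans (coeff-+ₚ (mono (+ 1) 1) (mono (+ 1) n +ₚ monos ms) k) (cong₂ _+ᶻ_ (coeff-mono 1 k)
  (trans (coeff-+ₚ (mono (+ 1) n) (monos ms) k) (cong₂ _+ᶻ_ (coeff-mono n k) (coeff-monos ms k))))))
  where
  coeff-minus-one : ∀ k → coeff (mono (- + 1) 0) k ≡ - δ 0 k
  coeff-minus-one zero    = refl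
  coeff-minus-one (suc k) = refl

-- Let the sequences h k coincide with x^(M k) beyond a common bound B < M k, where M is
-- strictly increasing.  Then h k ≠ h l for k < l: at M l, h l has coefficient 1
-- and h k has coefficient 0.
module Separation (h : ℕ → Seq) (M : ℕ → ℕ) (B : ℕ) (M-mono : ∀ {k l} → k < l → M k < M l)
                  (B<M : ∀ k → B < M k) (tail : ∀ k X → B < X → h k X ≡ δ (M k) X) where

  increasing-differ : ∀ {k l} → k < l → h k ≗ h l → ⊥
  increasing-differ {k} {l} k<l hk≗hl = 0≢1 (begin
    + 0              ≡⟨ sym (δ-other (M k) (M l) (<⇒≢ (M-mono k<l))) ⟩
    δ (M k) (M l)    ≡⟨ sym (tail k (M l) (B<M l)) ⟩
    h k (M l)        ≡⟨ hk≗hl (M l) ⟩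
    h l (M l)        ≡⟨ tail l (M l) (B<M l) ⟩
    δ (M l) (M l)    ≡⟨ δ-self (M l) ⟩
    + 1              ∎)
    where
    0≢1 : + 0 ≢ + 1
    0≢1 ()

  separate : ∀ k l → h k ≗ h l → k ≡ l
  separate k l hk≗hl with <-cmp k l
  ... | tri< k<l _ _ = ⊥-elim (increasing-differ k<l hk≗hl)
  ... | tri≈ _ k≡l _ = k≡l
  ... | tri> _ _ k>l = ⊥-elim (increasing-differ k>l (λ X → sym (hk≗hl X)))

module Rows (g : ℕ) where

  -- Writing n = g + 1, the gap condition Gap n a b reads a + g ≤ b.
  n : ℕ
  n = suc g

  row : ℕ → Seq
  row o = δ (o + 1) ⊕ δ (o + n)

  rows : ℕ → (ℕ → ℕ) → ℕ → List ℕ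
  rows M o zero    = M ∷ []
  rows M o (suc r) = (o 0 + 1) ∷ (o 0 + n) ∷ rows M (λ j → o (suc j)) r

  listSeq-rows : ∀ M o r → listSeq (rows M o r) ≗ sumₛ r (λ j → row (o j)) ⊕ δ M
  listSeq-rows M o zero    k = ℤ.+-comm (δ M k) (+ 0)
  listSeq-rows M o (suc r) k = begin
    δ (o 0 + 1) k +ᶻ (δ (o 0 + n) k +ᶻ listSeq (rows M (λ j → o (suc j)) r) k)
      ≡⟨ cong (λ u → δ (o 0 + 1) k +ᶻ (δ (o 0 + n) k +ᶻ u)) (listSeq-rows M (λ j → o (suc j)) r k) ⟩
    δ (o 0 + 1) k +ᶻ (δ (o 0 + n) k +ᶻ (sumₛ r (λ j → row (o (suc j))) k +ᶻ δ M k))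
      ≡⟨ +-regroup-row (δ (o 0 + 1) k) (δ (o 0 + n) k) (sumₛ r (λ j → row (o (suc j))) k) (δ M k) ⟩
    (δ (o 0 + 1) k +ᶻ δ (o 0 + n) k +ᶻ sumₛ r (λ j → row (o (suc j))) k) +ᶻ δ M k ∎

  rows-linked : ∀ M o → (∀ j → o j + n + g ≤ o (suc j) + 1) →
                ∀ r → o r + n + g ≤ M → Linked (Gap n) ((o 0 + n) ∷ rows M (λ j → o (suc j)) r)
  rows-linked M o step zero    last = last ∷ [-]
  rows-linked M o step (suc r) last =
    step 0 ∷ ≤-reflexive (+-assoc (o 1) 1 g) ∷ rows-linked M (λ j → o (suc j)) (λ j → step (suc j)) r last

module Construction (p₁ g : ℕ) where

  open Rows g public

  p : ℕ
  p = suc p₁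

  -- Row offsets are multiples of N ≡ 1 (mod p), with N large enough to respect the gaps.
  N : ℕ
  N = suc ((n + g) * p)

  exponents : ℕ → List ℕ
  exponents M = rows M (λ j → suc j * N) p₁

  -- The terms -1 + x + x^n of fPoly complete the rows to j = 0, ..., p - 1.
  coeff-f : ∀ M → coeff (fPoly n (exponents M)) ≗ (δ M ⊝ δ 0) ⊕ sumₛ p (λ j → row (j * N))
  coeff-f M k = begin
    coeff (fPoly n (exponents M)) k
      ≡⟨ coeff-fPoly n (exponents M) k ⟩
    - δ 0 k +ᶻ (δ 1 k +ᶻ (δ n k +ᶻ listSeq (exponents M) k))
      ≡⟨ cong (λ u → - δ 0 k +ᶻ (δ 1 k +ᶻ (δ n k +ᶻ u))) (listSeq-rows M (λ j → suc j * N) p₁ k) ⟩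
    - δ 0 k +ᶻ (δ 1 k +ᶻ (δ n k +ᶻ (sumₛ p₁ (λ j → row (suc j * N)) k +ᶻ δ M k)))
      ≡⟨ +-regroup-f (δ 0 k) (δ 1 k) (δ n k) (sumₛ p₁ (λ j → row (suc j * N)) k) (δ M k) ⟩
    (δ M k -ᶻ δ 0 k) +ᶻ ((δ 1 k +ᶻ δ n k) +ᶻ sumₛ p₁ (λ j → row (suc j * N)) k) ∎

  rows-divisible : Φ p ∣ₛ sumₛ p (λ j → row (j * N))
  rows-divisible = ∣ₛ-resp (λ k → sym (sum-⊕ p (λ j → δ (j * N + 1)) (λ j → δ (j * N + n)) k))
                           (∣ₛ-⊕ (Φ∣row-sum p (n + g) 1) (Φ∣row-sum p (n + g) n))

  -- Together with x^(c·p) ≡ 1, this gives Φ p ∣ f for leading exponent c·p.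
  f-divisible : ∀ c → Φ p ∣ₚ fPoly n (exponents (c * p))
  f-divisible c = ∣ₛ⇒∣ₚ {f = fPoly n (exponents (c * p))} (∣ₛ-resp (λ k → sym (coeff-f (c * p) k))
                                (∣ₛ-⊕ (mono-mod p (Φ∣xᵖ-1 p) 0 c) rows-divisible))

  n+g<N : n + g < N
  n+g<N = s≤s (m≤m*n (n + g) p)

  row-top : ∀ j → j * N + n + g < suc j * N
  row-top j = ≤-trans (≤-reflexive (cong suc (+-assoc (j * N) n g)))
                      (≤-trans (+-monoʳ-< (j * N) n+g<N) (≤-reflexive (+-comm (j * N) N)))

  f-linked : ∀ M → p₁ * N + n + g ≤ M → Linked (Gap n) (n ∷ exponents M)
  f-linked M last = rows-linked M (λ j → j * N) step p₁ last
    where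
    step : ∀ j → j * N + n + g ≤ suc j * N + 1
    step j = ≤-trans (<⇒≤ (row-top j)) (m≤m+n (suc j * N) 1)

  f-beyond : ∀ M X → p₁ * N + n < X → coeff (fPoly n (exponents M)) X ≡ δ M X
  f-beyond M X top<X = begin
    coeff (fPoly n (exponents M)) X                      ≡⟨ coeff-f M X ⟩
    (δ M X -ᶻ δ 0 X) +ᶻ sumₛ p (λ j → row (j * N)) X
      ≡⟨ cong₂ (λ u v → (δ M X -ᶻ u) +ᶻ v) (δ-other 0 X (<⇒≢ (≤-<-trans z≤n top<X)))
                                           (sum-vanish p (λ j → row (j * N)) X row-vanishes) ⟩
    (δ M X -ᶻ + 0) +ᶻ + 0                                ≡⟨ trans (ℤ.+-identityʳ _) (ℤ.+-identityʳ _) ⟩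
    δ M X                                                ∎
    where
    row-vanishes : ∀ j → j < p → row (j * N) X ≡ + 0
    row-vanishes j (s≤s j≤p₁) = cong₂ _+ᶻ_ (δ-other _ X (<⇒≢ (≤-<-trans (+-monoʳ-≤ (j * N) (s≤s z≤n)) jN+n<X)))
                                           (δ-other _ X (<⇒≢ jN+n<X))
      where
      jN+n<X : j * N + n < X
      jN+n<X = ≤-<-trans (+-monoˡ-≤ n (*-monoˡ-≤ N j≤p₁)) top<X

-- The theorem.  The k-th polynomial has leading exponent M k = (N + k)·p; of the
-- hypotheses on p only p ≥ 1 is used.
mainTheorem5 : (p : ℕ) → Prime p → 3 ≤ p → (n : ℕ) → 2 ≤ n →
    Σ (ℕ → List ℕ) (λ F →
      (∀ k → Linked (Gap n) (n ∷ F k) × (Φ p ∣ₚ fPoly n (F k)))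
      × (∀ k l → fPoly n (F k) ≈ₚ fPoly n (F l) → k ≡ l))
mainTheorem5 (suc p₁) _ (s≤s _) (suc (suc n')) (s≤s (s≤s _)) =
  F , (λ k → f-linked (M k) (<⇒≤ (top<M k)) , f-divisible (N + k)) , separate
  where
  open Construction p₁ (suc n')

  M : ℕ → ℕ
  M k = (N + k) * p

  F : ℕ → List ℕ
  F k = exponents (M k)

  top<M : ∀ k → p₁ * N + n + suc n' < M k
  top<M k = <-≤-trans (row-top p₁) (≤-trans (≤-reflexive (*-comm p N)) (*-monoˡ-≤ p (m≤m+n N k)))

  open Separation (λ k → coeff (fPoly n (F k))) M (p₁ * N + n)
         (λ k<l → *-monoˡ-< p (+-monoʳ-< N k<l))
         (λ k → ≤-<-trans (m≤m+n (p₁ * N + n) (suc n')) (top<M k))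
         (λ k X → f-beyond (M k) X)
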